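{- Let $k\ge 3$, $\tau\in\mathcal{S}_k$ with $\tau(k-1)=k-1$, $\tau(k)=k$, and let $F$ be a forest on $[n]$. Applying the shuffle operation to a special vertex $v$ of $F$ preserves the set of special vertices of $F$. Moreover, any vertex of $F$ that is not special retains its original label.
   Context: Forests on $[n]$ are unordered rooted forests with vertices labeled bijectively by $[n]$. An instance of a pattern $\rho\in\mathcal{S}_j$ is a sequence of vertices $v_1,\dots,v_j$ with $v_a$ a strict ancestor of $v_b$ for $a<b$ and labels in the same relative order as $\rho$; $v_j$ is its endpoint. Let $\bar\tau\in\mathcal{S}_{k-1}$ be given by $\bar\tau(i)=\tau(i)$ for $1\le i\le k-2$ and $\bar\tau(k-1)=k-1$. A vertex is special if it is the endpoint of some instance of $\bar\tau$. For a special vertex $v$, let $L$ be the label set of the subtree rooted at $v$ (all descendants of $v$, including $v$) and let $x=\max L$. To shuffle $v$: label $v$ with $x$ and relabel the strict descendants of $v$ with $L\setminus\{x\}$ so that the relative order of their labels is preserved; all other vertices keep their labels. -}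

module Defs where

open import Data.Nat as ℕ using (ℕ; zero; suc)
open import Data.Fin as Fin using (Fin; toℕ; inject₁; fromℕ)
open import Data.Fin.Permutation using (Permutation′; _⟨$⟩ʳ_)
open import Data.Maybe using (Maybe; just; nothing)
open import Data.Product using (Σ; ∃; _×_; _,_)
open import Data.Sum using (_⊎_)
open import Data.Bool using (if_then_else_)
open import Relation.Binary.PropositionalEquality using (_≡_)
open import Relation.Nullary using (¬_)
open import Function.Bundles using (_⇔_)

module _ {n : ℕ} (parent : Fin n → Maybe (Fin n)) where

  data StrictAnc (u : Fin n) : Fin n → Set where
    par  : ∀ {w} → parent w ≡ just u → StrictAnc u w
    step : ∀ {w x} → parent w ≡ just x → StrictAnc u x → StrictAnc u w

record Forest (n : ℕ) : Set where
  field
    parent  : Fin n → Maybe (Fin n)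
    acyclic : ∀ v → ¬ StrictAnc parent v v
open Forest public

module _ {n : ℕ} (F : Forest n) where

  Anc : Fin n → Fin n → Set
  Anc = StrictAnc (parent F)

  InSubtree : Fin n → Fin n → Set
  InSubtree v w = w ≡ v ⊎ Anc v w

  -- label of a vertex under a labelling (labels in Fin n stand for [n])
  module _ (lab : Permutation′ n) where

    -- an instance of the pattern ρ (given by its values, compared by order)
    -- of length suc j, with endpoint e
    IsInstance : (j : ℕ) → (ρ : Fin (suc j) → ℕ) → (vs : Fin (suc j) → Fin n) → Set
    IsInstance j ρ vs =
      (∀ a b → a Fin.< b → Anc (vs a) (vs b)) ×
      (∀ a b → ((lab ⟨$⟩ʳ vs a) Fin.< (lab ⟨$⟩ʳ vs b)) ⇔ (ρ a ℕ.< ρ b))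

    HasInstanceEndingAt : (j : ℕ) → (ρ : Fin (suc j) → ℕ) → Fin n → Set
    HasInstanceEndingAt j ρ e =
      Σ (Fin (suc j) → Fin n) λ vs → IsInstance j ρ vs × vs (fromℕ j) ≡ e

-- For τ ∈ S_k with k = m + 3 (indices 0-based: Fin k stands for [k]),
-- τbar ∈ S_{k-1}: τbar(i) = τ(i) for 1 ≤ i ≤ k-2 and τbar(k-1) = k-1
-- (0-based: positions 0..m of Fin (m+2) use τ, position m+1 gets value m+1).
τbar : (m : ℕ) → Permutation′ (suc (suc (suc m))) → Fin (suc (suc m)) → ℕ
τbar m τ i = if toℕ i ℕ.<ᵇ suc m then toℕ (τ ⟨$⟩ʳ inject₁ i) else suc m

module _ {n : ℕ} (m : ℕ) (τ : Permutation′ (suc (suc (suc m)))) (F : Forest n) where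

  Special : Permutation′ n → Fin n → Set
  Special lab v = HasInstanceEndingAt F lab (suc m) (τbar m τ) v

  -- lab' is the result of shuffling v in (F, lab):
  -- v gets x = max L, strict descendants get L ∖ {x} in the same relative
  -- order, all other vertices keep their labels. (lab' being a bijection
  -- makes the strict descendants' labels exactly L ∖ {x}.)
  IsShuffle : Permutation′ n → Fin n → Permutation′ n → Set
  IsShuffle lab v lab' =
    (∀ w → ¬ InSubtree F v w → lab' ⟨$⟩ʳ w ≡ lab ⟨$⟩ʳ w) ×
    (Σ (Fin n) λ u → InSubtree F v u ×
        (∀ w → InSubtree F v w → lab ⟨$⟩ʳ w Fin.≤ lab ⟨$⟩ʳ u) ×
        lab' ⟨$⟩ʳ v ≡ lab ⟨$⟩ʳ u) ×
    (∀ w w' → Anc F v w → Anc F v w' →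
        ((lab ⟨$⟩ʳ w) Fin.< (lab ⟨$⟩ʳ w')) ⇔ ((lab' ⟨$⟩ʳ w) Fin.< (lab' ⟨$⟩ʳ w')))

module Submission where

open import Defs
open import Data.Nat as ℕ using (ℕ; zero; suc)
import Data.Nat.Properties as ℕP
open import Data.Fin using (Fin; toℕ; fromℕ; inject₁; _<_; _≤_)
import Data.Fin.Properties as FinP
open import Data.Fin.Induction using (spo-wellFounded; <-wellFounded)
open import Data.Fin.Permutation using (Permutation′; _⟨$⟩ʳ_; _⟨$⟩ˡ_; inverseʳ)
open import Data.Maybe using (just; nothing)
open import Data.Maybe.Properties using (just-injective)
open import Data.Bool using (false)
open import Data.Bool.Properties using (T-≡)
open import Data.Vec.Functional using (updateAt)
open import Data.Vec.Functional.Properties using (updateAt-updates; updateAt-minimal)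
open import Data.Product using (_×_; _,_; proj₁; proj₂)
open import Data.Sum using (inj₁; inj₂)
open import Data.Empty using (⊥; ⊥-elim)
open import Function.Bundles using (_⇔_; mk⇔; Injection; Equivalence)
open import Function.Properties.Inverse using (↔⇒↣)
open import Induction.WellFounded using (Acc; acc)
open import Relation.Binary.Structures using (IsStrictPartialOrder)
open import Relation.Binary.Definitions using (tri<; tri≈; tri>)
open import Relation.Binary.PropositionalEquality
open import Relation.Nullary using (¬_; Dec; yes; no)

-- Write c for the label of v. The shuffle moves labels only inside the subtree of v,
-- raises the label of v and keeps the relative order of its strict descendants; by
-- induction on labels it therefore fixes every vertex labelled below c.
-- Since τbar ends with its maximum, w is special iff some instance of the first k-2
-- letters lies on strict ancestors of w, all labelled below w.  Such a witness for w
-- survives the shuffle when w is outside the subtree (its ancestors are outside too)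
-- or when w is labelled below c (so is the witness).  Otherwise w lies in the subtree
-- and is labelled at least c both before and after the shuffle, and the witness of v,
-- whose labels are below c and hence fixed, serves for w.  Conversely a vertex whose
-- label changed is in the subtree with label at least c, hence special.

<ᵇ-irrefl : ∀ k → (k ℕ.<ᵇ k) ≡ false
<ᵇ-irrefl zero    = refl
<ᵇ-irrefl (suc k) = <ᵇ-irrefl k

module _ {n : ℕ} (F : Forest n) where

  anc-trans : ∀ {u v w} → Anc F u v → Anc F v w → Anc F u w
  anc-trans u⊏v (par e)      = step e u⊏v
  anc-trans u⊏v (step e u⊏x) = step e (anc-trans u⊏v u⊏x)

  anc-inSubtree-trans : ∀ {u v w} → Anc F u v → InSubtree F v w → Anc F u w
  anc-inSubtree-trans u⊏v (inj₁ refl) = u⊏v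
  anc-inSubtree-trans u⊏v (inj₂ v⊏w)  = anc-trans u⊏v v⊏w

  inSubtree-anc-trans : ∀ {u v w} → InSubtree F u v → Anc F v w → InSubtree F u w
  inSubtree-anc-trans (inj₁ refl) v⊏w = inj₂ v⊏w
  inSubtree-anc-trans (inj₂ u⊏v)  v⊏w = inj₂ (anc-trans u⊏v v⊏w)

  anc-isStrictPartialOrder : IsStrictPartialOrder _≡_ (Anc F)
  anc-isStrictPartialOrder = record
    { isEquivalence = isEquivalence
    ; irrefl        = λ { refl → acyclic F _ }
    ; trans         = anc-trans
    ; <-resp-≈      = (λ { refl u⊏v → u⊏v }) , (λ { refl u⊏v → u⊏v })
    }

  anc? : ∀ u w → Dec (Anc F u w)
  anc? u w = go (spo-wellFounded anc-isStrictPartialOrder w)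
    where
    go : ∀ {w} → Acc (Anc F) w → Dec (Anc F u w)
    go {w} (acc rec) with parent F w in pw
    ... | nothing = no λ { (par e) → nothing≢just (trans (sym pw) e)
                         ; (step e _) → nothing≢just (trans (sym pw) e) }
      where
      nothing≢just : ∀ {x : Fin n} → nothing ≢ just x
      nothing≢just ()
    ... | just p with p FinP.≟ u | go (rec (par pw))
    ...   | yes refl | _     = yes (par pw)
    ...   | no _     | yes a = yes (step pw a)
    ...   | no p≢u   | no ¬a = no λ
      { (par e)    → p≢u (just-injective (trans (sym pw) e))
      ; (step e a) → ¬a (subst (Anc F u) (just-injective (trans (sym e) pw)) a) }

  AgreeOutside : Fin n → Permutation′ n → Permutation′ n → Set
  AgreeOutside v σ σ′ = ∀ x → ¬ InSubtree F v x → σ′ ⟨$⟩ʳ x ≡ σ ⟨$⟩ʳ x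

  inSubtree? : ∀ v w → Dec (InSubtree F v w)
  inSubtree? v w with w FinP.≟ v | anc? v w
  ... | yes w≡v | _     = yes (inj₁ w≡v)
  ... | no _    | yes a = yes (inj₂ a)
  ... | no w≢v  | no ¬a = no λ { (inj₁ w≡v) → w≢v w≡v ; (inj₂ a) → ¬a a }

module _ {n : ℕ} where

  perm-injective : (π : Permutation′ n) → ∀ {i j} → π ⟨$⟩ʳ i ≡ π ⟨$⟩ʳ j → i ≡ j
  perm-injective π = Injection.injective (↔⇒↣ π)

  AgreeBelow : Fin n → Permutation′ n → Permutation′ n → Set
  AgreeBelow c σ σ′ = ∀ x → σ ⟨$⟩ʳ x < c → σ′ ⟨$⟩ʳ x ≡ σ ⟨$⟩ʳ x

  agreeBelow-sym : ∀ {c} σ σ′ → AgreeBelow c σ σ′ → AgreeBelow c σ′ σ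
  agreeBelow-sym {c} σ σ′ agree x σ′x<c = begin
    σ ⟨$⟩ʳ x   ≡⟨ cong (σ ⟨$⟩ʳ_) (sym y≡x) ⟩
    σ ⟨$⟩ʳ y   ≡⟨ σy≡σ′x ⟩
    σ′ ⟨$⟩ʳ x  ∎
    where
    open ≡-Reasoning
    y = σ ⟨$⟩ˡ (σ′ ⟨$⟩ʳ x)
    σy≡σ′x : σ ⟨$⟩ʳ y ≡ σ′ ⟨$⟩ʳ x
    σy≡σ′x = inverseʳ σ
    y≡x : y ≡ x
    y≡x = perm-injective σ′ (trans (agree y (subst (_< c) (sym σy≡σ′x) σ′x<c)) σy≡σ′x)

  agreeBelow-≤ : ∀ {c} σ σ′ → AgreeBelow c σ σ′ → ∀ x → c ≤ σ ⟨$⟩ʳ x → c ≤ σ′ ⟨$⟩ʳ x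
  agreeBelow-≤ {c} σ σ′ agree x c≤σx = ℕP.≮⇒≥ λ σ′x<c →
    ℕP.<⇒≱ (subst (_< c) (sym (agreeBelow-sym σ σ′ agree x σ′x<c)) σ′x<c) c≤σx

module _ {n : ℕ} (m : ℕ) (τ : Permutation′ (suc (suc (suc m)))) (F : Forest n)
         (lab : Permutation′ n) (v : Fin n) (lab′ : Permutation′ n)
         (shuffle : IsShuffle m τ F lab v lab′) where

  private
    outside : AgreeOutside F v lab lab′
    outside = proj₁ shuffle

    v-raised : lab ⟨$⟩ʳ v ≤ lab′ ⟨$⟩ʳ v
    v-raised with proj₁ (proj₂ shuffle)
    ... | u , _ , u-max , lab′v≡labu = subst (lab ⟨$⟩ʳ v ≤_) (sym lab′v≡labu) (u-max v (inj₁ refl))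

    reflects-< : ∀ x y → Anc F v x → Anc F v y → lab′ ⟨$⟩ʳ x < lab′ ⟨$⟩ʳ y → lab ⟨$⟩ʳ x < lab ⟨$⟩ʳ y
    reflects-< x y v⊏x v⊏y = Equivalence.from (proj₂ (proj₂ shuffle) x y v⊏x v⊏y)

    fixed-if-smaller-fixed : ∀ x → lab ⟨$⟩ʳ x < lab ⟨$⟩ʳ v
      → (∀ y → lab ⟨$⟩ʳ y < lab ⟨$⟩ʳ x → lab′ ⟨$⟩ʳ y ≡ lab ⟨$⟩ʳ y)
      → lab′ ⟨$⟩ʳ x ≡ lab ⟨$⟩ʳ x
    fixed-if-smaller-fixed x x<v ih with inSubtree? F v x
    ... | no v⋢x          = outside x v⋢x
    ... | yes (inj₁ refl) = ⊥-elim (FinP.<-irrefl refl x<v)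
    ... | yes (inj₂ v⊏x) with FinP.<-cmp (lab′ ⟨$⟩ʳ x) (lab ⟨$⟩ʳ x)
    ...   | tri≈ _ fixed _   = fixed
    ...   | tri< lowered _ _ =
      ⊥-elim (FinP.<-irrefl (trans (sym laby≡lab′x) (cong (lab ⟨$⟩ʳ_) y≡x)) lowered)
      where
      y = lab ⟨$⟩ˡ (lab′ ⟨$⟩ʳ x)
      laby≡lab′x : lab ⟨$⟩ʳ y ≡ lab′ ⟨$⟩ʳ x
      laby≡lab′x = inverseʳ lab
      y≡x : y ≡ x
      y≡x = perm-injective lab′
        (trans (ih y (subst (_< lab ⟨$⟩ʳ x) (sym laby≡lab′x) lowered)) laby≡lab′x)
    ...   | tri> _ _ raised = ⊥-elim (preimage (inSubtree? F v y))
      where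
      y = lab′ ⟨$⟩ˡ (lab ⟨$⟩ʳ x)
      lab′y≡labx : lab′ ⟨$⟩ʳ y ≡ lab ⟨$⟩ʳ x
      lab′y≡labx = inverseʳ lab′
      preimage : Dec (InSubtree F v y) → ⊥
      preimage (no v⋢y) = v⋢y (subst (InSubtree F v)
        (sym (perm-injective lab (trans (sym (outside y v⋢y)) lab′y≡labx))) (inj₂ v⊏x))
      preimage (yes (inj₁ refl)) =
        ℕP.<⇒≱ (subst (_< lab ⟨$⟩ʳ v) (sym lab′y≡labx) x<v) v-raised
      preimage (yes (inj₂ v⊏y)) = FinP.<-irrefl (trans (sym (ih y y<x)) lab′y≡labx) y<x
        where
        y<x : lab ⟨$⟩ʳ y < lab ⟨$⟩ʳ x
        y<x = reflects-< y x v⊏y v⊏x (subst (_< lab′ ⟨$⟩ʳ x) (sym lab′y≡labx) raised)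

  shuffle-agreeBelow : AgreeBelow (lab ⟨$⟩ʳ v) lab lab′
  shuffle-agreeBelow x = go x (<-wellFounded (lab ⟨$⟩ʳ x))
    where
    go : ∀ x → Acc _<_ (lab ⟨$⟩ʳ x) → lab ⟨$⟩ʳ x < lab ⟨$⟩ʳ v → lab′ ⟨$⟩ʳ x ≡ lab ⟨$⟩ʳ x
    go x (acc rec) x<v = fixed-if-smaller-fixed x x<v
      λ y y<x → go y (rec y<x) (FinP.<-trans y<x x<v)

module SpecialVertices (m : ℕ) (τ : Permutation′ (suc (suc (suc m))))
    (τ-fixes-k-1 : τ ⟨$⟩ʳ inject₁ (fromℕ (suc m)) ≡ inject₁ (fromℕ (suc m)))
    (τ-fixes-k : τ ⟨$⟩ʳ fromℕ (suc (suc m)) ≡ fromℕ (suc (suc m))) where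

  last : Fin (suc (suc m))
  last = fromℕ (suc m)

  ≢last⇒<last : ∀ {i} → i ≢ last → i < last
  ≢last⇒<last {i} i≢last = FinP.≤∧≢⇒< (FinP.≤fromℕ i) i≢last

  τbar-last : τbar m τ last ≡ suc m
  τbar-last rewrite FinP.toℕ-fromℕ m | <ᵇ-irrefl m = refl

  τbar-maximum : ∀ i → i ≢ last → τbar m τ i ℕ.< τbar m τ last
  τbar-maximum i i≢last
    rewrite τbar-last
          | Equivalence.to T-≡ (ℕP.<⇒<ᵇ (subst (toℕ i ℕ.<_) (FinP.toℕ-fromℕ (suc m)) (≢last⇒<last i≢last)))
          = τ<k-1
    where
    t = τ ⟨$⟩ʳ inject₁ i
    t≢k-1 : t ≢ inject₁ last
    t≢k-1 t≡ = i≢last (FinP.inject₁-injective (perm-injective τ (trans t≡ (sym τ-fixes-k-1))))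
    t≢k : t ≢ fromℕ (suc (suc m))
    t≢k t≡ = FinP.fromℕ≢inject₁ (sym (perm-injective τ (trans t≡ (sym τ-fixes-k))))
    τ<k-1 : toℕ t ℕ.< suc m
    τ<k-1 = subst (toℕ t ℕ.<_) (trans (FinP.toℕ-inject₁ last) (FinP.toℕ-fromℕ (suc m)))
      (FinP.≤∧≢⇒< (FinP.<⇒≤pred (FinP.≤∧≢⇒< (FinP.≤fromℕ t) t≢k)) t≢k-1)

  module _ {n : ℕ} (F : Forest n) where

    -- The entry of vertices at last is irrelevant: only the first k-2 letters of τbar
    -- are matched, so that Special L w ⇔ PrefixBelow L (L ⟨$⟩ʳ w) w.
    record PrefixBelow (L : Permutation′ n) (c w : Fin n) : Set where
      field
        vertices : Fin (suc (suc m)) → Fin n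
        chain    : ∀ a b → a ≢ last → b ≢ last → a < b → Anc F (vertices a) (vertices b)
        order    : ∀ a b → a ≢ last → b ≢ last →
                   (L ⟨$⟩ʳ vertices a < L ⟨$⟩ʳ vertices b) ⇔ (τbar m τ a ℕ.< τbar m τ b)
        below    : ∀ i → i ≢ last → Anc F (vertices i) w × L ⟨$⟩ʳ vertices i < c
    open PrefixBelow

    special⇒prefixBelow : ∀ L {w} → Special m τ F L w → PrefixBelow L (L ⟨$⟩ʳ w) w
    special⇒prefixBelow L (us , (chain , order) , refl) = record
      { vertices = us
      ; chain    = λ a b _ _ → chain a b
      ; order    = λ a b _ _ → order a b
      ; below    = λ i i≢last → chain i last (≢last⇒<last i≢last)
                              , Equivalence.from (order i last) (τbar-maximum i i≢last)
      }

    prefixBelow-cong : ∀ {L c w} L′ (p : PrefixBelow L c w)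
      → (∀ i → i ≢ last → L′ ⟨$⟩ʳ vertices p i ≡ L ⟨$⟩ʳ vertices p i) → PrefixBelow L′ c w
    prefixBelow-cong {c = c} L′ p agree = record
      { vertices = vertices p
      ; chain    = chain p
      ; order    = λ a b a≢last b≢last →
          subst₂ (λ x y → (x < y) ⇔ _) (sym (agree a a≢last)) (sym (agree b b≢last))
                 (order p a b a≢last b≢last)
      ; below    = λ i i≢last → proj₁ (below p i i≢last)
                              , subst (_< c) (sym (agree i i≢last)) (proj₂ (below p i i≢last))
      }

    prefixBelow⇒special : ∀ {L c v w} → PrefixBelow L c v → InSubtree F v w
      → c ≤ L ⟨$⟩ʳ w → Special m τ F L w
    prefixBelow⇒special {L} {c} {v} {w} p v⊑w c≤w = us , (chain′ , order′) , us-last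
      where
      us : Fin (suc (suc m)) → Fin n
      us = updateAt (vertices p) last (λ _ → w)
      us-last : us last ≡ w
      us-last = updateAt-updates last (vertices p)
      us-prefix : ∀ i → i ≢ last → us i ≡ vertices p i
      us-prefix i i≢last = updateAt-minimal i last (vertices p) i≢last
      vertex<w : ∀ i → i ≢ last → L ⟨$⟩ʳ vertices p i < L ⟨$⟩ʳ w
      vertex<w i i≢last = ℕP.<-≤-trans (proj₂ (below p i i≢last)) c≤w
      chain′ : ∀ a b → a < b → Anc F (us a) (us b)
      chain′ a b a<b with a FinP.≟ last | b FinP.≟ last
      ... | yes refl | _ = ⊥-elim (ℕP.<⇒≱ a<b (FinP.≤fromℕ b))
      ... | no a≢last | yes refl rewrite us-prefix a a≢last | us-last =
        anc-inSubtree-trans F (proj₁ (below p a a≢last)) v⊑w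
      ... | no a≢last | no b≢last rewrite us-prefix a a≢last | us-prefix b b≢last =
        chain p a b a≢last b≢last a<b
      order′ : ∀ a b → (L ⟨$⟩ʳ us a < L ⟨$⟩ʳ us b) ⇔ (τbar m τ a ℕ.< τbar m τ b)
      order′ a b with a FinP.≟ last | b FinP.≟ last
      ... | yes refl | yes refl = mk⇔ (λ a<a → ⊥-elim (FinP.<-irrefl refl a<a))
                                      (λ a<a → ⊥-elim (ℕP.<-irrefl refl a<a))
      ... | yes refl | no b≢last rewrite us-prefix b b≢last | us-last =
        mk⇔ (λ w<b → ⊥-elim (FinP.<-asym w<b (vertex<w b b≢last)))
            (λ last<b → ⊥-elim (ℕP.<-asym last<b (τbar-maximum b b≢last)))
      ... | no a≢last | yes refl rewrite us-prefix a a≢last | us-last =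
        mk⇔ (λ _ → τbar-maximum a a≢last) (λ _ → vertex<w a a≢last)
      ... | no a≢last | no b≢last rewrite us-prefix a a≢last | us-prefix b b≢last =
        order p a b a≢last b≢last

    special-transfer : ∀ {c v} L L′
      → AgreeOutside F v L L′
      → AgreeBelow c L L′
      → PrefixBelow L′ c v
      → ∀ {w} → Special m τ F L w → Special m τ F L′ w
    special-transfer {c} {v} L L′ outside agree pv {w} special-w
      with L ⟨$⟩ʳ w FinP.<? c | inSubtree? F v w
    ... | yes w<c | _ = prefixBelow⇒special
      (prefixBelow-cong L′ p λ i i≢last → agree _ (FinP.<-trans (proj₂ (below p i i≢last)) w<c))
      (inj₁ refl) (FinP.≤-reflexive (sym (agree w w<c)))
      where p = special⇒prefixBelow L special-w
    ... | no w≮c | yes v⊑w = prefixBelow⇒special pv v⊑w (agreeBelow-≤ L L′ agree w (ℕP.≮⇒≥ w≮c))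
    ... | no _   | no v⋢w = prefixBelow⇒special
      (prefixBelow-cong L′ p λ i i≢last → outside _ λ v⊑i →
        v⋢w (inSubtree-anc-trans F v⊑i (proj₁ (below p i i≢last))))
      (inj₁ refl) (FinP.≤-reflexive (sym (outside w v⋢w)))
      where p = special⇒prefixBelow L special-w

    ¬special⇒fixed : ∀ {c v} L L′
      → AgreeOutside F v L L′
      → AgreeBelow c L L′
      → PrefixBelow L c v
      → ∀ w → ¬ Special m τ F L w → L′ ⟨$⟩ʳ w ≡ L ⟨$⟩ʳ w
    ¬special⇒fixed {c} {v} L L′ outside agree pv w ¬special-w
      with L ⟨$⟩ʳ w FinP.<? c | inSubtree? F v w
    ... | yes w<c | _      = agree w w<c
    ... | no w≮c | yes v⊑w = ⊥-elim (¬special-w (prefixBelow⇒special pv v⊑w (ℕP.≮⇒≥ w≮c)))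
    ... | no _   | no v⋢w  = outside w v⋢w

lemma4p3 : (m : ℕ) → (τ : Permutation′ (suc (suc (suc m))))
    → τ ⟨$⟩ʳ inject₁ (fromℕ (suc m)) ≡ inject₁ (fromℕ (suc m))
    → τ ⟨$⟩ʳ fromℕ (suc (suc m)) ≡ fromℕ (suc (suc m))
    → (n : ℕ) → (F : Forest n) → (lab : Permutation′ n) → (v : Fin n)
    → Special m τ F lab v
    → (lab' : Permutation′ n) → IsShuffle m τ F lab v lab'
    → (∀ w → Special m τ F lab w ⇔ Special m τ F lab' w)
      × (∀ w → ¬ Special m τ F lab w → lab' ⟨$⟩ʳ w ≡ lab ⟨$⟩ʳ w)
lemma4p3 m τ τ-fixes-k-1 τ-fixes-k n F lab v special-v lab′ shuffle =
    (λ w → mk⇔ (special-transfer F lab lab′ outside low pv′)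
               (special-transfer F lab′ lab outside′ low′ pv))
  , ¬special⇒fixed F lab lab′ outside low pv
  where
  open SpecialVertices m τ τ-fixes-k-1 τ-fixes-k
  outside : AgreeOutside F v lab lab′
  outside = proj₁ shuffle
  outside′ : AgreeOutside F v lab′ lab
  outside′ x v⋢x = sym (outside x v⋢x)
  low : AgreeBelow (lab ⟨$⟩ʳ v) lab lab′
  low = shuffle-agreeBelow m τ F lab v lab′ shuffle
  low′ : AgreeBelow (lab ⟨$⟩ʳ v) lab′ lab
  low′ = agreeBelow-sym lab lab′ low
  pv : PrefixBelow F lab (lab ⟨$⟩ʳ v) v
  pv = special⇒prefixBelow F lab special-v
  pv′ : PrefixBelow F lab′ (lab ⟨$⟩ʳ v) v
  pv′ = prefixBelow-cong F lab′ pv λ i i≢last → low _ (proj₂ (PrefixBelow.below pv i i≢last))
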